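{- Let $(C,d)$ be a finite metric with $k:=|C|$ and let $r>0$. Let $\ell=1+\lfloor\log_{3/2}k\rfloor$ and $h=4r\lfloor\log_3 k\rfloor$. The output of Algorithm PartitionGeneralMetric on $((C,d),r)$ is an $r$-well-separated partition with at most $\ell$ layers and parameters $(h,\dots,h)$.
   Context: Algorithm PartitionGeneralMetric$((C,d),r)$: set $U\leftarrow C$, $i\leftarrow0$. While $U\neq\emptyset$: set $i\leftarrow i+1$ (start layer $i$), $j\leftarrow 0$, $U'\leftarrow U$; while $U'\neq\emptyset$: set $j\leftarrow j+1$, select any $u\in U'$, set $C_{i,j}\leftarrow\{u\}$, $N_0\leftarrow\{u\}$, remove $u$ from $U'$ and $U$, and $s\leftarrow1$; while $s\neq0$ and $U'\neq\emptyset$: let $N_s=\{x\in U':\exists v\in N_{s-1}, d(v,x)\le 2r\}$; if $|N_s|\ge 2|C_{i,j}|$ then add $N_s$ to $C_{i,j}$, remove $N_s$ from $U'$ and $U$, and set $s\leftarrow s+1$; otherwise remove $N_s$ from $U'$ (but not from $U$) and set $s\leftarrow0$. Output the groups $C_{i,j}$, where layer $i$ consists of the groups $C_{i,1},C_{i,2},\dots$. An $r$-well-separated partition of $(C,d)$ with $\ell$ layers and parameters $(h_1,\dots,h_\ell)$ is a partition of $C$ into pairwise disjoint groups $C_{i,j}$, $i\in[\ell]$, $j\in[\ell_i]$, covering $C$, such that points in different groups of the same layer are at distance more than $2r$, and every group on layer $i$ has diameter at most $h_i$.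
   Formalization: The distances of the finite metric d and the radius r take values in the rationals. -}

module Defs where

open import Data.Nat as ℕ using (ℕ; zero; suc; _^_)
open import Data.Bool using (Bool; true; false; _∧_)
open import Data.Fin using (Fin; toℕ)
open import Data.Fin.Subset using (Subset; _∈_; ⁅_⁆; _─_; _∪_; ∣_∣; ⊤; Nonempty; Empty)
open import Data.Vec using (tabulate; lookup)
open import Data.List using (List; []; _∷_; _++_; [_]; length; allFin)
open import Data.Bool.ListAction using (any)
import Data.List as L
open import Data.Product using (Σ; ∃; ∃-syntax; _×_; _,_)
open import Data.Integer using (+_)
open import Data.Rational using (ℚ; 0ℚ; _≤_; _<_; _*_; _+_; _/_)
open import Data.Rational.Properties using (_≤?_)
open import Relation.Nullary using (does; ¬_)
open import Relation.Binary.PropositionalEquality using (_≡_)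

record IsMetric {k : ℕ} (d : Fin k → Fin k → ℚ) : Set where
  field
    nonneg   : ∀ x y → 0ℚ ≤ d x y
    zero⇔eq₁ : ∀ x y → d x y ≡ 0ℚ → x ≡ y
    zero⇔eq₂ : ∀ x → d x x ≡ 0ℚ
    sym      : ∀ x y → d x y ≡ d y x
    triangle : ∀ x y z → d x z ≤ d x y + d y z

ℕ→ℚ : ℕ → ℚ
ℕ→ℚ n = (+ n) / 1

two : ℚ
two = ℕ→ℚ 2

-- Floors of logarithms:  m = ⌊ log_{p/q} k ⌋  iff  (p/q)^m ≤ k < (p/q)^(m+1)
-- (written without division:  p^m ≤ k·q^m  and  k·q^(m+1) < p^(m+1)).

IsFloorLog : (p q k m : ℕ) → Set
IsFloorLog p q k m = (p ^ m ℕ.≤ k ℕ.* q ^ m) × (k ℕ.* q ^ suc m ℕ.< p ^ suc m)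

-- Algorithm PartitionGeneralMetric((C,d), r), as a relation between the
-- input and its possible outputs (the choice "select any u ∈ U'" is
-- nondeterministic, so every admissible choice sequence is a run).

module Algorithm {k : ℕ} (d : Fin k → Fin k → ℚ) (r : ℚ) where

  next : (U' Nprev : Subset k) → Subset k
  next U' Nprev = tabulate λ x →
    lookup U' x ∧ any (λ v → lookup Nprev v ∧ does (d v x ≤? two * r)) (allFin k)

  -- innermost loop:  Grow U U' C N  U₁ U'₁ C₁ :
  -- starting with sets U, U', current group C_{i,j} = C and N_{s-1} = N
  -- (with s ≠ 0), the loop terminates with U₁, U'₁ and group C₁.
  data Grow : (U U' Cg N : Subset k) → (U₁ U'₁ Cg₁ : Subset k) → Set where
    exitEmpty : ∀ {U U' Cg N} → Empty U' → Grow U U' Cg N U U' Cg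
    extend    : ∀ {U U' Cg N U₁ U'₁ Cg₁} → Nonempty U' →
                2 ℕ.* ∣ Cg ∣ ℕ.≤ ∣ next U' N ∣ →
                Grow (U ─ next U' N) (U' ─ next U' N) (Cg ∪ next U' N) (next U' N) U₁ U'₁ Cg₁ →
                Grow U U' Cg N U₁ U'₁ Cg₁
    stop      : ∀ {U U' Cg N} → Nonempty U' →
                ∣ next U' N ∣ ℕ.< 2 ℕ.* ∣ Cg ∣ →
                Grow U U' Cg N U (U' ─ next U' N) Cg

  -- middle loop (one layer):  Layer U U' gs U₁ gs₁ :
  -- with groups gs built so far in this layer, the loop ends with U₁ and
  -- the full list of groups gs₁ of the layer.
  data Layer : (U U' : Subset k) → (gs : List (Subset k)) →
               (U₁ : Subset k) → (gs₁ : List (Subset k)) → Set where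
    done : ∀ {U U' gs} → Empty U' → Layer U U' gs U gs
    pick : ∀ {U U' gs U₁ U'₁ Cg U₂ gs₂} (u : Fin k) → u ∈ U' →
           Grow (U ─ ⁅ u ⁆) (U' ─ ⁅ u ⁆) ⁅ u ⁆ ⁅ u ⁆ U₁ U'₁ Cg →
           Layer U₁ U'₁ (gs ++ [ Cg ]) U₂ gs₂ →
           Layer U U' gs U₂ gs₂

  -- outer loop:  Run U ls out : with layers ls built so far and remaining
  -- set U, the algorithm outputs the list of layers out.
  data Run : (U : Subset k) → (ls : List (List (Subset k))) →
             (out : List (List (Subset k))) → Set where
    finish : ∀ {U ls} → Empty U → Run U ls ls
    layer  : ∀ {U ls U₁ gs out} → Nonempty U →
             Layer U U [] U₁ gs →
             Run U₁ (ls ++ [ gs ]) out →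
             Run U ls out

  Output : List (List (Subset k)) → Set
  Output out = Run ⊤ [] out

-- r-well-separated partitions.  A partition is a list of layers, each
-- layer a list of groups; group (i , j) is the j-th group of layer i.

module _ {k : ℕ} where

  Group : (P : List (List (Subset k))) (i : Fin (length P)) →
          Fin (length (L.lookup P i)) → Subset k
  Group P i j = L.lookup (L.lookup P i) j

  record IsWellSeparatedPartition (d : Fin k → Fin k → ℚ) (r : ℚ)
           (P : List (List (Subset k))) (h : Fin (length P) → ℚ) : Set where
    field
      disjoint  : ∀ i j i' j' x → x ∈ Group P i j → x ∈ Group P i' j' →
                  (toℕ i ≡ toℕ i') × (toℕ j ≡ toℕ j')
      covering  : ∀ x → ∃[ i ] ∃[ j ] (x ∈ Group P i j)
      separated : ∀ i j j' x y → ¬ (j ≡ j') → x ∈ Group P i j → y ∈ Group P i j' →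
                  two * r < d x y
      diameter  : ∀ i j x y → x ∈ Group P i j → y ∈ Group P i j → d x y ≤ h i

{-# OPTIONS --safe #-}

-- Each group grows from its seed in rounds. An accepted round at least triples the group
-- and enlarges its radius around the seed by 2r, so a group built in t rounds has
-- 3^t ≤ k points, all within 2rt of the seed: t ≤ ⌊log₃ k⌋ and the diameter is at most
-- 4r⌊log₃ k⌋. Growth stops at the first neighbourhood N with |N| < 2|C|, whose points are
-- merely postponed to a later layer; hence a layer postpones fewer than twice as many points
-- as it groups, 3|U_{i+1}| ≤ 2|U_i|, and there are at most 1 + ⌊log_{3/2} k⌋ layers.
-- Groups of one layer are more than 2r apart because, when a group is closed, every point
-- within 2r of it is removed from U' as well.

module Submission where

open import Defs
open import Data.Nat using (ℕ; zero; suc; z≤n; s≤s; _≥_; _^_)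
open import Data.Fin using (Fin)
open import Data.List using (length)
open import Data.Product using (_×_; ∃; ∃-syntax; _,_; proj₁; proj₂)
open import Data.Rational using (ℚ; 0ℚ; 1ℚ; _<_; _≤_; _+_; _*_; mkℚ; *≤*; NonNegative; nonNegative)
import Data.Nat as ℕ
import Data.Nat.Properties as ℕP
open import Data.Nat.Tactic.RingSolver using (solve-∀)
open import Data.Nat.Induction using (<-wellFounded)
open import Induction.WellFounded using (Acc; acc)
open import Data.Nat.Coprimality using (1-coprimeTo) renaming (sym to coprime-sym)
import Data.Integer as ℤ
import Data.Integer.Properties as ℤP
import Data.Rational.Properties as ℚP
open import Data.Rational.Solver using (module +-*-Solver)
open import Data.Bool using (Bool; T; _∧_)
open import Data.Bool.Properties using (T-≡; T-∧)
import Data.Fin as Fin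
open import Data.Fin.Subset
  using (Subset; inside; outside; _∈_; _∉_; _⊆_; _─_; _-_; _∪_; ⁅_⁆; ∣_∣; ⊤; Empty; Nonempty)
open import Data.Fin.Subset.Properties
  using ( _∈?_; drop-∷-⊆; ⊆-trans; p─q⊆p; x∈p∧x∉q⇒x∈p─q; x∈p∪q⁻; p⊆p∪q; q⊆p∪q
        ; ∣p∣≤∣p∪q∣; x∈⁅x⁆; x∈⁅y⁆⇒x≡y; ∣⁅x⁆∣≡1; x∈p⇒∣p-x∣<∣p∣; p⊆q⇒∣p∣≤∣q∣; ∣p∣≤n; ∈⊤; ∣⊤∣≡n
        ; nonempty?; Empty-unique; ∣⊥∣≡0 )
open import Data.Vec as Vec using ([]; _∷_; here; there; tabulate)
open import Data.Vec.Properties using (lookup∘tabulate; []=⇒lookup; lookup⇒[]=)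
open import Data.List as List using (List; []; _∷_; _++_; [_]; allFin)
open import Data.List.Properties using (length-++)
open import Data.List.Membership.Propositional using () renaming (_∈_ to _∈ₗ_)
open import Data.List.Membership.Propositional.Properties using (∈-allFin; ∈-lookup)
open import Data.List.Relation.Unary.Any as Any using (Any)
open import Data.List.Relation.Unary.Any.Properties using (any⁺; any⁻; ++⁺ˡ; ++⁺ʳ; lookup-index)
open import Data.List.Relation.Unary.All as All using (All; []; _∷_)
import Data.List.Relation.Unary.All.Properties as All
open import Data.List.Relation.Unary.AllPairs using (AllPairs; []; _∷_)
import Data.List.Relation.Unary.AllPairs.Properties as AllPairs
open import Data.Sum using (_⊎_; inj₁; inj₂; [_,_]′)
import Data.Sum as Sum
open import Data.Empty using (⊥-elim)
open import Function using (id; _∘_; Equivalence)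
open import Relation.Nullary using (¬_; Dec; yes; no; does)
open import Relation.Nullary.Decidable using (dec-true)
open import Relation.Binary.Definitions using (Symmetric)
open import Relation.Binary.PropositionalEquality hiding ([_])

open Equivalence using (to; from)

Disjoint : ∀ {n} → Subset n → Subset n → Set
Disjoint p q = ∀ {x} → x ∈ p → x ∉ q

x∈p─q⇒x∉q : ∀ {n} (p q : Subset n) {x} → x ∈ p ─ q → x ∉ q
x∈p─q⇒x∉q (_ ∷ p) (inside ∷ q) () here
x∈p─q⇒x∉q (_ ∷ p) (_ ∷ q) (there x∈p─q) (there x∈q) = x∈p─q⇒x∉q p q x∈p─q x∈q

Disjoint-⊆ʳ : ∀ {n} {p q q′ : Subset n} → q′ ⊆ q → Disjoint p q → Disjoint p q′
Disjoint-⊆ʳ q′⊆q p∩q=∅ x∈p = p∩q=∅ x∈p ∘ q′⊆q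

Disjoint-─ : ∀ {n} {p q : Subset n} → Disjoint q (p ─ q)
Disjoint-─ {p = p} {q} x∈q x∈p─q = x∈p─q⇒x∉q p q x∈p─q x∈q

Disjoint-∪-─ : ∀ {n} {p q : Subset n} (r : Subset n) → Disjoint p q → Disjoint (p ∪ r) (q ─ r)
Disjoint-∪-─ {p = p} {q} r p∩q=∅ x∈p∪r x∈q─r with x∈p∪q⁻ p r x∈p∪r
... | inj₁ x∈p = p∩q=∅ x∈p (p─q⊆p q r x∈q─r)
... | inj₂ x∈r = x∈p─q⇒x∉q q r x∈q─r x∈r

─-monoˡ-⊆ : ∀ {n} {p q : Subset n} (r : Subset n) → p ⊆ q → p ─ r ⊆ q ─ r
─-monoˡ-⊆ {p = p} r p⊆q x∈p─r = x∈p∧x∉q⇒x∈p─q (p⊆q (p─q⊆p p r x∈p─r)) (x∈p─q⇒x∉q p r x∈p─r)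

∪-lub : ∀ {n} {p q r : Subset n} → p ⊆ r → q ⊆ r → p ∪ q ⊆ r
∪-lub {p = p} {q} p⊆r q⊆r x∈p∪q = [ p⊆r , q⊆r ]′ (x∈p∪q⁻ p q x∈p∪q)

x∈p⇒⁅x⁆⊆p : ∀ {n} {p : Subset n} {x} → x ∈ p → ⁅ x ⁆ ⊆ p
x∈p⇒⁅x⁆⊆p {x = x} x∈p y∈⁅x⁆ rewrite x∈⁅y⁆⇒x≡y x y∈⁅x⁆ = x∈p

∈-split : ∀ {n} {p : Subset n} (q : Subset n) {x} → x ∈ p → x ∈ p ─ q ⊎ x ∈ q
∈-split q {x} x∈p with x ∈? q
... | yes x∈q = inj₂ x∈q
... | no  x∉q = inj₁ (x∈p∧x∉q⇒x∈p─q x∈p x∉q)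

Nonempty⇒∣p∣>0 : ∀ {n} {p : Subset n} → Nonempty p → 0 ℕ.< ∣ p ∣
Nonempty⇒∣p∣>0 (_ , x∈p) = ℕP.≤-<-trans z≤n (x∈p⇒∣p-x∣<∣p∣ x∈p)

∣p─q∣+∣q∣≡∣p∣ : ∀ {n} (p q : Subset n) → q ⊆ p → ∣ p ─ q ∣ ℕ.+ ∣ q ∣ ≡ ∣ p ∣
∣p─q∣+∣q∣≡∣p∣ []            []            _   = refl
∣p─q∣+∣q∣≡∣p∣ (inside  ∷ p) (inside  ∷ q) q⊆p =
  trans (ℕP.+-suc _ _) (cong suc (∣p─q∣+∣q∣≡∣p∣ p q (drop-∷-⊆ q⊆p)))
∣p─q∣+∣q∣≡∣p∣ (inside  ∷ p) (outside ∷ q) q⊆p = cong suc (∣p─q∣+∣q∣≡∣p∣ p q (drop-∷-⊆ q⊆p))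
∣p─q∣+∣q∣≡∣p∣ (outside ∷ p) (inside  ∷ q) q⊆p with () ← q⊆p here
∣p─q∣+∣q∣≡∣p∣ (outside ∷ p) (outside ∷ q) q⊆p = ∣p─q∣+∣q∣≡∣p∣ p q (drop-∷-⊆ q⊆p)

Empty⇒∣p∣≡0 : ∀ {n} {p : Subset n} → Empty p → ∣ p ∣ ≡ 0
Empty⇒∣p∣≡0 {n} p-empty = trans (cong ∣_∣ (Empty-unique p-empty)) (∣⊥∣≡0 n)

∣p-x∣+1≡∣p∣ : ∀ {n} {p : Subset n} {x} → x ∈ p → ∣ p - x ∣ ℕ.+ 1 ≡ ∣ p ∣
∣p-x∣+1≡∣p∣ {p = p} {x} x∈p =
  trans (cong (∣ p - x ∣ ℕ.+_) (sym (∣⁅x⁆∣≡1 x))) (∣p─q∣+∣q∣≡∣p∣ p ⁅ x ⁆ (x∈p⇒⁅x⁆⊆p x∈p))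

∣p∪q∣≤∣p∣+∣q∣ : ∀ {n} (p q : Subset n) → ∣ p ∪ q ∣ ℕ.≤ ∣ p ∣ ℕ.+ ∣ q ∣
∣p∪q∣≤∣p∣+∣q∣ []            []            = z≤n
∣p∪q∣≤∣p∣+∣q∣ (inside  ∷ p) (inside  ∷ q) =
  s≤s (ℕP.≤-trans (∣p∪q∣≤∣p∣+∣q∣ p q) (ℕP.+-monoʳ-≤ ∣ p ∣ (ℕP.n≤1+n ∣ q ∣)))
∣p∪q∣≤∣p∣+∣q∣ (inside  ∷ p) (outside ∷ q) = s≤s (∣p∪q∣≤∣p∣+∣q∣ p q)
∣p∪q∣≤∣p∣+∣q∣ (outside ∷ p) (inside  ∷ q) =
  ℕP.≤-trans (s≤s (∣p∪q∣≤∣p∣+∣q∣ p q)) (ℕP.≤-reflexive (sym (ℕP.+-suc _ _)))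
∣p∪q∣≤∣p∣+∣q∣ (outside ∷ p) (outside ∷ q) = ∣p∪q∣≤∣p∣+∣q∣ p q

drop-∷-Disjoint : ∀ {n} {s t} {p q : Subset n} → Disjoint (s ∷ p) (t ∷ q) → Disjoint p q
drop-∷-Disjoint p∩q=∅ x∈p x∈q = p∩q=∅ (there x∈p) (there x∈q)

Disjoint⇒∣p∣+∣q∣≤∣p∪q∣ : ∀ {n} (p q : Subset n) → Disjoint p q → ∣ p ∣ ℕ.+ ∣ q ∣ ℕ.≤ ∣ p ∪ q ∣
Disjoint⇒∣p∣+∣q∣≤∣p∪q∣ []            []            _       = z≤n
Disjoint⇒∣p∣+∣q∣≤∣p∪q∣ (inside  ∷ p) (inside  ∷ q) p∩q=∅ with () ← p∩q=∅ here here
Disjoint⇒∣p∣+∣q∣≤∣p∪q∣ (inside  ∷ p) (outside ∷ q) p∩q=∅ =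
  s≤s (Disjoint⇒∣p∣+∣q∣≤∣p∪q∣ p q (drop-∷-Disjoint p∩q=∅))
Disjoint⇒∣p∣+∣q∣≤∣p∪q∣ (outside ∷ p) (inside  ∷ q) p∩q=∅ =
  ℕP.≤-trans (ℕP.≤-reflexive (ℕP.+-suc _ _))
             (s≤s (Disjoint⇒∣p∣+∣q∣≤∣p∪q∣ p q (drop-∷-Disjoint p∩q=∅)))
Disjoint⇒∣p∣+∣q∣≤∣p∪q∣ (outside ∷ p) (outside ∷ q) p∩q=∅ =
  Disjoint⇒∣p∣+∣q∣≤∣p∪q∣ p q (drop-∷-Disjoint p∩q=∅)

module _ {n : ℕ} where

  T-lookup⇒∈ : ∀ {p : Subset n} {x} → T (Vec.lookup p x) → x ∈ p
  T-lookup⇒∈ {p} {x} t = lookup⇒[]= x p (to T-≡ t)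

  ∈⇒T-lookup : ∀ {p : Subset n} {x} → x ∈ p → T (Vec.lookup p x)
  ∈⇒T-lookup x∈p = from T-≡ ([]=⇒lookup x∈p)

  ∈-tabulate⁻ : ∀ {f : Fin n → Bool} {x} → x ∈ tabulate f → T (f x)
  ∈-tabulate⁻ {f} {x} x∈ = subst T (lookup∘tabulate f x) (∈⇒T-lookup x∈)

  ∈-tabulate⁺ : ∀ {f : Fin n → Bool} {x} → T (f x) → x ∈ tabulate f
  ∈-tabulate⁺ {f} {x} t = T-lookup⇒∈ (subst T (sym (lookup∘tabulate f x)) t)

-- Relation.Nullary.Decidable's toWitness and fromWitness are phrased with isYes, not does.
T-does⁻ : ∀ {A : Set} (a? : Dec A) → T (does a?) → A
T-does⁻ (yes a) _ = a
T-does⁻ (no _) ()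

T-does⁺ : ∀ {A : Set} (a? : Dec A) → A → T (does a?)
T-does⁺ a? a = from T-≡ (dec-true a? a)

All-lookup : ∀ {A : Set} {P : A → Set} {xs} → All P xs → ∀ i → P (List.lookup xs i)
All-lookup pxs i = All.lookup pxs (∈-lookup i)

AllPairs-lookup : ∀ {A : Set} {R : A → A → Set} → Symmetric R → ∀ {xs} → AllPairs R xs →
                  ∀ {i j} → i ≢ j → R (List.lookup xs i) (List.lookup xs j)
AllPairs-lookup sym (_  ∷ _)   {Fin.zero}  {Fin.zero}  i≢j = ⊥-elim (i≢j refl)
AllPairs-lookup sym (px ∷ _)   {Fin.zero}  {Fin.suc j} _   = All-lookup px j
AllPairs-lookup sym (px ∷ _)   {Fin.suc i} {Fin.zero}  _   = sym (All-lookup px i)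
AllPairs-lookup sym (_  ∷ pxs) {Fin.suc i} {Fin.suc j} i≢j =
  AllPairs-lookup sym pxs (i≢j ∘ cong Fin.suc)

3*m≤2*n⇒m<n : ∀ {m n} → 3 ℕ.* m ℕ.≤ 2 ℕ.* n → 0 ℕ.< n → m ℕ.< n
3*m≤2*n⇒m<n {n = n} 3m≤2n 0<n = ℕP.≰⇒> λ n≤m →
  ℕP.<⇒≱ 0<n (ℕP.+-cancelʳ-≤ (2 ℕ.* n) n 0 (ℕP.≤-trans (ℕP.*-monoʳ-≤ 3 n≤m) 3m≤2n))

bound-descends : ∀ {a b} n → 3 ℕ.* a ℕ.≤ 2 ℕ.* b →
                 2 ^ suc n ℕ.* b ℕ.< 3 ^ suc n → 2 ^ n ℕ.* a ℕ.< 3 ^ n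
bound-descends {a} {b} n 3a≤2b bound = ℕP.*-cancelˡ-< 3 _ _ (begin-strict
  3 ℕ.* (2 ^ n ℕ.* a)    ≡⟨ left-comm 3 (2 ^ n) a ⟩
  2 ^ n ℕ.* (3 ℕ.* a)    ≤⟨ ℕP.*-monoʳ-≤ (2 ^ n) 3a≤2b ⟩
  2 ^ n ℕ.* (2 ℕ.* b)    ≡⟨ left-comm (2 ^ n) 2 b ⟩
  2 ℕ.* (2 ^ n ℕ.* b)    ≡⟨ ℕP.*-assoc 2 (2 ^ n) b ⟨
  2 ^ suc n ℕ.* b        <⟨ bound ⟩
  3 ^ suc n              ∎)
  where
  open ℕP.≤-Reasoning
  left-comm : ∀ x y z → x ℕ.* (y ℕ.* z) ≡ y ℕ.* (x ℕ.* z)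
  left-comm = solve-∀

3^t≤n<3^[1+m]⇒t≤m : ∀ {t n m} → 3 ^ t ℕ.≤ n → n ℕ.< 3 ^ suc m → t ℕ.≤ m
3^t≤n<3^[1+m]⇒t≤m 3^t≤n n<3^[1+m] =
  ℕP.≮⇒≥ λ m<t → ℕP.<⇒≱ (ℕP.≤-<-trans 3^t≤n n<3^[1+m]) (ℕP.^-monoʳ-≤ 3 m<t)

ℕ→ℚ≡mkℚ : ∀ n → ℕ→ℚ n ≡ mkℚ (ℤ.+ n) 0 (coprime-sym (1-coprimeTo n))
ℕ→ℚ≡mkℚ n = ℚP.normalize-coprime _

ℕ→ℚ-suc : ∀ n → ℕ→ℚ (suc n) ≡ ℕ→ℚ n + 1ℚ
ℕ→ℚ-suc n rewrite ℕ→ℚ≡mkℚ n =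
  ℚP./-cong {p₁ = ℤ.+ suc n} {p₂ = ℤ.+ n ℤ.* ℤ.+ 1 ℤ.+ ℤ.+ 1} {q₂ = 1}
    (sym (trans (cong (ℤ._+ ℤ.+ 1) (ℤP.*-identityʳ (ℤ.+ n))) (cong ℤ.+_ (ℕP.+-comm n 1)))) refl

ℕ→ℚ-mono-≤ : ∀ {m n} → m ℕ.≤ n → ℕ→ℚ m ≤ ℕ→ℚ n
ℕ→ℚ-mono-≤ {m} {n} m≤n rewrite ℕ→ℚ≡mkℚ m | ℕ→ℚ≡mkℚ n =
  *≤* (ℤP.*-monoʳ-≤-nonNeg (ℤ.+ 1) (ℤ.+≤+ m≤n))

ℕ→ℚ-suc-* : ∀ n p → ℕ→ℚ (suc n) * p ≡ ℕ→ℚ n * p + p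
ℕ→ℚ-suc-* n p = begin
  ℕ→ℚ (suc n) * p     ≡⟨ cong (_* p) (ℕ→ℚ-suc n) ⟩
  (ℕ→ℚ n + 1ℚ) * p    ≡⟨ ℚP.*-distribʳ-+ p (ℕ→ℚ n) 1ℚ ⟩
  ℕ→ℚ n * p + 1ℚ * p  ≡⟨ cong (ℕ→ℚ n * p +_) (ℚP.*-identityˡ p) ⟩
  ℕ→ℚ n * p + p       ∎
  where open ≡-Reasoning

module Loops {k : ℕ} (d : Fin k → Fin k → ℚ) (r : ℚ) where
  open Algorithm d r

  variable
    U U' U₀ U₁ U'₁ U₂ Cg Cg₁ N W : Subset k
    u : Fin k
    gs gs₂ : List (Subset k)
    ls out : List (List (Subset k))

  ∈-next⁻ : ∀ {x} → x ∈ next U' N → x ∈ U' × ∃[ v ] v ∈ N × d v x ≤ two * r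
  ∈-next⁻ {U'} {N} {x} x∈next
    with x∈U' , near ← to T-∧ (∈-tabulate⁻ x∈next)
    with v , v-near ← Any.satisfied (any⁻ _ (allFin k) near)
    with v∈N , close ← to T-∧ v-near
    = T-lookup⇒∈ x∈U' , v , T-lookup⇒∈ v∈N , T-does⁻ (d v x ℚP.≤? two * r) close

  ∈-next⁺ : ∀ {x v} → x ∈ U' → v ∈ N → d v x ≤ two * r → x ∈ next U' N
  ∈-next⁺ {U'} {N} {x} {v} x∈U' v∈N close =
    ∈-tabulate⁺ (from T-∧ (∈⇒T-lookup x∈U' , any⁺ _ (Any.map (λ { refl → v-near }) (∈-allFin v))))
    where
    v-near : T (Vec.lookup N v ∧ does (d v x ℚP.≤? two * r))
    v-near = from T-∧ (∈⇒T-lookup v∈N , T-does⁺ (d v x ℚP.≤? two * r) close)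

  next⊆ : next U' N ⊆ U'
  next⊆ {U'} {N} x∈next = proj₁ (∈-next⁻ {U'} {N} x∈next)

  Separated : Subset k → Subset k → Set
  Separated A B = ∀ {x y} → x ∈ A → y ∈ B → two * r < d x y

  Separated-⊆ʳ : ∀ {A B B′} → B′ ⊆ B → Separated A B → Separated A B′
  Separated-⊆ʳ B′⊆B sep x∈A = sep x∈A ∘ B′⊆B

  IsFrontier : (N Cg U' : Subset k) → Set
  IsFrontier N Cg U' = ∀ {x y} → x ∈ Cg → y ∈ U' → d x y ≤ two * r → x ∈ N

  grow-⊆ : Grow U U' Cg N U₁ U'₁ Cg₁ → U₁ ⊆ U × U'₁ ⊆ U'
  grow-⊆ (exitEmpty _) = id , id
  grow-⊆ {U} {U'} (extend _ _ g) =
    let U₁⊆ , U'₁⊆ = grow-⊆ g in ⊆-trans U₁⊆ (p─q⊆p U _) , ⊆-trans U'₁⊆ (p─q⊆p U' _)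
  grow-⊆ {U' = U'} (stop _ _) = id , p─q⊆p U' _

  grow-⊆-preserved : U' ⊆ U → Grow U U' Cg N U₁ U'₁ Cg₁ → U'₁ ⊆ U₁
  grow-⊆-preserved U'⊆U (exitEmpty _) = U'⊆U
  grow-⊆-preserved {U' = U'} {N = N} U'⊆U (extend _ _ g) =
    grow-⊆-preserved (─-monoˡ-⊆ (next U' N) U'⊆U) g
  grow-⊆-preserved {U' = U'} U'⊆U (stop _ _) = ⊆-trans (p─q⊆p U' _) U'⊆U

  grow-group-⊆ : Cg ⊆ W → U' ⊆ W → Grow U U' Cg N U₁ U'₁ Cg₁ → Cg₁ ⊆ W
  grow-group-⊆ Cg⊆W _ (exitEmpty _) = Cg⊆W
  grow-group-⊆ {U' = U'} {N = N} Cg⊆W U'⊆W (extend _ _ g) =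
    grow-group-⊆ (∪-lub Cg⊆W (⊆-trans (next⊆ {U'} {N}) U'⊆W)) (⊆-trans (p─q⊆p U' _) U'⊆W) g
  grow-group-⊆ Cg⊆W _ (stop _ _) = Cg⊆W

  grow-disjoint : Disjoint Cg U → Grow U U' Cg N U₁ U'₁ Cg₁ → Disjoint Cg₁ U₁
  grow-disjoint Cg∩U=∅ (exitEmpty _)  = Cg∩U=∅
  grow-disjoint {U' = U'} {N = N} Cg∩U=∅ (extend _ _ g) =
    grow-disjoint (Disjoint-∪-─ (next U' N) Cg∩U=∅) g
  grow-disjoint Cg∩U=∅ (stop _ _)     = Cg∩U=∅

  grow-covers : Grow U U' Cg N U₁ U'₁ Cg₁ → ∀ {x} → x ∈ U ⊎ x ∈ Cg → x ∈ U₁ ⊎ x ∈ Cg₁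
  grow-covers (exitEmpty _) = id
  grow-covers {U' = U'} {Cg} {N} (extend _ _ g) =
    grow-covers g ∘ [ Sum.map₂ (q⊆p∪q Cg X) ∘ ∈-split X , inj₂ ∘ p⊆p∪q X ]′
    where
    X : Subset k
    X = next U' N
  grow-covers (stop _ _) = id

  far-from-rest : IsFrontier N Cg U' → ∀ {x y} → x ∈ Cg → y ∈ U' ─ next U' N → ¬ d x y ≤ two * r
  far-from-rest {N} {U' = U'} frontier x∈Cg y∈rest close =
    x∈p─q⇒x∉q U' _ y∈rest (∈-next⁺ y∈U' (frontier x∈Cg y∈U' close) close)
    where
    y∈U' : _ ∈ U'
    y∈U' = p─q⊆p U' _ y∈rest

  grow-separated : IsFrontier N Cg U' → Grow U U' Cg N U₁ U'₁ Cg₁ → Separated Cg₁ U'₁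
  grow-separated _ (exitEmpty U'-empty) _ y∈U' = ⊥-elim (U'-empty (_ , y∈U'))
  grow-separated {N} {Cg} {U'} frontier (extend _ _ g) = grow-separated frontier′ g
    where
    frontier′ : IsFrontier (next U' N) (Cg ∪ next U' N) (U' ─ next U' N)
    frontier′ x∈ y∈rest close with x∈p∪q⁻ Cg _ x∈
    ... | inj₁ x∈Cg = ⊥-elim (far-from-rest {N} {Cg} {U'} frontier x∈Cg y∈rest close)
    ... | inj₂ x∈next = x∈next
  grow-separated {N} {Cg} {U'} frontier (stop _ _) x∈Cg y∈rest =
    ℚP.≰⇒> (far-from-rest {N} {Cg} {U'} frontier x∈Cg y∈rest)

  -- An accepted round does not increase 3∣U∣ − ∣U'∣ + 2∣Cg∣, and the final rejected
  -- neighbourhood leaves U' only and has fewer than 2∣Cg∣ points. Stated without subtraction.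
  grow-potential : U' ⊆ U → Grow U U' Cg N U₁ U'₁ Cg₁ →
                   3 ℕ.* ∣ U₁ ∣ ℕ.+ ∣ U' ∣ ℕ.≤ 3 ℕ.* ∣ U ∣ ℕ.+ ∣ U'₁ ∣ ℕ.+ 2 ℕ.* ∣ Cg ∣
  grow-potential _ (exitEmpty _) = ℕP.m≤m+n _ _
  grow-potential {U'} {U} {Cg} {N} {U₁} {U'₁} U'⊆U (extend _ _ g) = begin
    3 ℕ.* ∣ U₁ ∣ ℕ.+ ∣ U' ∣
      ≡⟨ cong (3 ℕ.* ∣ U₁ ∣ ℕ.+_) (sym (∣p─q∣+∣q∣≡∣p∣ U' X (next⊆ {U'} {N}))) ⟩
    3 ℕ.* ∣ U₁ ∣ ℕ.+ (∣ U' ─ X ∣ ℕ.+ ∣ X ∣)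
      ≡⟨ sym (ℕP.+-assoc (3 ℕ.* ∣ U₁ ∣) _ _) ⟩
    3 ℕ.* ∣ U₁ ∣ ℕ.+ ∣ U' ─ X ∣ ℕ.+ ∣ X ∣
      ≤⟨ ℕP.+-monoˡ-≤ ∣ X ∣ (grow-potential (─-monoˡ-⊆ X U'⊆U) g) ⟩
    3 ℕ.* ∣ U ─ X ∣ ℕ.+ ∣ U'₁ ∣ ℕ.+ 2 ℕ.* ∣ Cg ∪ X ∣ ℕ.+ ∣ X ∣
      ≤⟨ ℕP.+-monoˡ-≤ ∣ X ∣ (ℕP.+-monoʳ-≤ (3 ℕ.* ∣ U ─ X ∣ ℕ.+ ∣ U'₁ ∣)
                                          (ℕP.*-monoʳ-≤ 2 (∣p∪q∣≤∣p∣+∣q∣ Cg X))) ⟩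
    3 ℕ.* ∣ U ─ X ∣ ℕ.+ ∣ U'₁ ∣ ℕ.+ 2 ℕ.* (∣ Cg ∣ ℕ.+ ∣ X ∣) ℕ.+ ∣ X ∣
      ≡⟨ regroup (∣ U ─ X ∣) (∣ U'₁ ∣) (∣ Cg ∣) (∣ X ∣) ⟩
    3 ℕ.* (∣ U ─ X ∣ ℕ.+ ∣ X ∣) ℕ.+ ∣ U'₁ ∣ ℕ.+ 2 ℕ.* ∣ Cg ∣
      ≡⟨ cong (λ n → 3 ℕ.* n ℕ.+ ∣ U'₁ ∣ ℕ.+ 2 ℕ.* ∣ Cg ∣)
              (∣p─q∣+∣q∣≡∣p∣ U X (⊆-trans (next⊆ {U'} {N}) U'⊆U)) ⟩
    3 ℕ.* ∣ U ∣ ℕ.+ ∣ U'₁ ∣ ℕ.+ 2 ℕ.* ∣ Cg ∣ ∎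
    where
    open ℕP.≤-Reasoning
    X : Subset k
    X = next U' N
    regroup : ∀ e w c x → 3 ℕ.* e ℕ.+ w ℕ.+ 2 ℕ.* (c ℕ.+ x) ℕ.+ x ≡ 3 ℕ.* (e ℕ.+ x) ℕ.+ w ℕ.+ 2 ℕ.* c
    regroup = solve-∀
  grow-potential {U'} {U} {Cg} {N} _ (stop _ small) = begin
    3 ℕ.* ∣ U ∣ ℕ.+ ∣ U' ∣
      ≡⟨ cong (3 ℕ.* ∣ U ∣ ℕ.+_) (sym (∣p─q∣+∣q∣≡∣p∣ U' X (next⊆ {U'} {N}))) ⟩
    3 ℕ.* ∣ U ∣ ℕ.+ (∣ U' ─ X ∣ ℕ.+ ∣ X ∣)
      ≤⟨ ℕP.+-monoʳ-≤ (3 ℕ.* ∣ U ∣) (ℕP.+-monoʳ-≤ ∣ U' ─ X ∣ (ℕP.<⇒≤ small)) ⟩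
    3 ℕ.* ∣ U ∣ ℕ.+ (∣ U' ─ X ∣ ℕ.+ 2 ℕ.* ∣ Cg ∣)
      ≡⟨ sym (ℕP.+-assoc (3 ℕ.* ∣ U ∣) _ _) ⟩
    3 ℕ.* ∣ U ∣ ℕ.+ ∣ U' ─ X ∣ ℕ.+ 2 ℕ.* ∣ Cg ∣ ∎
    where
    open ℕP.≤-Reasoning
    X : Subset k
    X = next U' N

  seeded-grow-potential : U' ⊆ U → u ∈ U' → Grow (U - u) (U' - u) ⁅ u ⁆ ⁅ u ⁆ U₁ U'₁ Cg →
                          3 ℕ.* ∣ U₁ ∣ ℕ.+ ∣ U' ∣ ℕ.≤ 3 ℕ.* ∣ U ∣ ℕ.+ ∣ U'₁ ∣
  seeded-grow-potential {U'} {U} {u} {U₁} {U'₁} U'⊆U u∈U' g = begin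
    3 ℕ.* ∣ U₁ ∣ ℕ.+ ∣ U' ∣
      ≡⟨ cong (3 ℕ.* ∣ U₁ ∣ ℕ.+_) (∣p-x∣+1≡∣p∣ u∈U') ⟨
    3 ℕ.* ∣ U₁ ∣ ℕ.+ (∣ U' - u ∣ ℕ.+ 1)
      ≡⟨ ℕP.+-assoc (3 ℕ.* ∣ U₁ ∣) _ 1 ⟨
    3 ℕ.* ∣ U₁ ∣ ℕ.+ ∣ U' - u ∣ ℕ.+ 1
      ≤⟨ ℕP.+-monoˡ-≤ 1 (grow-potential (─-monoˡ-⊆ ⁅ u ⁆ U'⊆U) g) ⟩
    3 ℕ.* ∣ U - u ∣ ℕ.+ ∣ U'₁ ∣ ℕ.+ 2 ℕ.* ∣ ⁅ u ⁆ ∣ ℕ.+ 1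
      ≡⟨ cong (λ n → 3 ℕ.* ∣ U - u ∣ ℕ.+ ∣ U'₁ ∣ ℕ.+ 2 ℕ.* n ℕ.+ 1) (∣⁅x⁆∣≡1 u) ⟩
    3 ℕ.* ∣ U - u ∣ ℕ.+ ∣ U'₁ ∣ ℕ.+ 2 ℕ.* 1 ℕ.+ 1
      ≡⟨ regroup (∣ U - u ∣) (∣ U'₁ ∣) ⟩
    3 ℕ.* (∣ U - u ∣ ℕ.+ 1) ℕ.+ ∣ U'₁ ∣
      ≡⟨ cong (λ n → 3 ℕ.* n ℕ.+ ∣ U'₁ ∣) (∣p-x∣+1≡∣p∣ (U'⊆U u∈U')) ⟩
    3 ℕ.* ∣ U ∣ ℕ.+ ∣ U'₁ ∣ ∎
    where
    open ℕP.≤-Reasoning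
    regroup : ∀ e w → 3 ℕ.* e ℕ.+ w ℕ.+ 2 ℕ.* 1 ℕ.+ 1 ≡ 3 ℕ.* (e ℕ.+ 1) ℕ.+ w
    regroup = solve-∀

  layer-potential : U' ⊆ U → Layer U U' gs U₂ gs₂ → 3 ℕ.* ∣ U₂ ∣ ℕ.+ ∣ U' ∣ ℕ.≤ 3 ℕ.* ∣ U ∣
  layer-potential {U'} {U} _ (done U'-empty) = ℕP.≤-reflexive (begin-equality
    3 ℕ.* ∣ U ∣ ℕ.+ ∣ U' ∣ ≡⟨ cong (3 ℕ.* ∣ U ∣ ℕ.+_) (Empty⇒∣p∣≡0 U'-empty) ⟩
    3 ℕ.* ∣ U ∣ ℕ.+ 0      ≡⟨ ℕP.+-identityʳ _ ⟩
    3 ℕ.* ∣ U ∣            ∎)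
    where open ℕP.≤-Reasoning
  layer-potential {U'} {U} {U₂ = U₂} U'⊆U (pick {U₁ = U₁} {U'₁} u u∈U' g l) =
    ℕP.+-cancelʳ-≤ ∣ U'₁ ∣ _ _ (begin
      3 ℕ.* ∣ U₂ ∣ ℕ.+ ∣ U' ∣ ℕ.+ ∣ U'₁ ∣  ≡⟨ swap-last (3 ℕ.* ∣ U₂ ∣) (∣ U' ∣) (∣ U'₁ ∣) ⟩
      3 ℕ.* ∣ U₂ ∣ ℕ.+ ∣ U'₁ ∣ ℕ.+ ∣ U' ∣  ≤⟨ ℕP.+-monoˡ-≤ ∣ U' ∣ (layer-potential U'₁⊆U₁ l) ⟩
      3 ℕ.* ∣ U₁ ∣ ℕ.+ ∣ U' ∣              ≤⟨ seeded-grow-potential U'⊆U u∈U' g ⟩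
      3 ℕ.* ∣ U ∣ ℕ.+ ∣ U'₁ ∣              ∎)
    where
    open ℕP.≤-Reasoning
    U'₁⊆U₁ : U'₁ ⊆ U₁
    U'₁⊆U₁ = grow-⊆-preserved (─-monoˡ-⊆ ⁅ u ⁆ U'⊆U) g
    swap-last : ∀ a b c → a ℕ.+ b ℕ.+ c ≡ a ℕ.+ c ℕ.+ b
    swap-last = solve-∀

  layer-shrinks : Layer U U [] U₁ gs → 3 ℕ.* ∣ U₁ ∣ ℕ.≤ 2 ℕ.* ∣ U ∣
  layer-shrinks {U} {U₁} lay = ℕP.+-cancelʳ-≤ ∣ U ∣ _ _ (begin
    3 ℕ.* ∣ U₁ ∣ ℕ.+ ∣ U ∣ ≤⟨ layer-potential id lay ⟩
    3 ℕ.* ∣ U ∣            ≡⟨ ℕP.+-comm ∣ U ∣ (2 ℕ.* ∣ U ∣) ⟩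
    2 ℕ.* ∣ U ∣ ℕ.+ ∣ U ∣  ∎)
    where open ℕP.≤-Reasoning

  run-length : Run U ls out → ∀ n → 2 ^ n ℕ.* ∣ U ∣ ℕ.< 3 ^ n → length out ℕ.≤ length ls ℕ.+ n
  run-length (finish _) n _ = ℕP.m≤m+n _ n
  run-length (layer U≠∅ _ _) zero ∣U∣<1 =
    ⊥-elim (ℕP.<⇒≱ ∣U∣<1 (ℕP.≤-trans (Nonempty⇒∣p∣>0 U≠∅) (ℕP.≤-reflexive (sym (ℕP.*-identityˡ _)))))
  run-length {ls = ls} (layer {gs = gs} _ lay run) (suc n) bound =
    ℕP.≤-trans (run-length run n (bound-descends n (layer-shrinks lay) bound))
               (ℕP.≤-reflexive (trans (cong (ℕ._+ n) (length-++ ls)) (ℕP.+-assoc (length ls) 1 n)))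

  next-shrinks : 0 ℕ.< ∣ Cg ∣ → 2 ℕ.* ∣ Cg ∣ ℕ.≤ ∣ next U' N ∣ → ∣ U' ─ next U' N ∣ ℕ.< ∣ U' ∣
  next-shrinks {Cg} {U'} {N} 0<∣Cg∣ big = begin-strict
    ∣ U' ─ X ∣            <⟨ ℕP.m<m+n _ (ℕP.<-≤-trans 0<∣Cg∣ (ℕP.≤-trans (ℕP.m≤m+n _ _) big)) ⟩
    ∣ U' ─ X ∣ ℕ.+ ∣ X ∣  ≡⟨ ∣p─q∣+∣q∣≡∣p∣ U' X (next⊆ {U'} {N}) ⟩
    ∣ U' ∣                ∎
    where
    open ℕP.≤-Reasoning
    X : Subset k
    X = next U' N

  grow-exists : Acc ℕ._<_ ∣ U' ∣ → 0 ℕ.< ∣ Cg ∣ →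
                ∃[ U₁ ] ∃[ U'₁ ] ∃[ Cg₁ ] Grow U U' Cg N U₁ U'₁ Cg₁
  grow-exists {U'} {Cg} {U} {N} (acc smaller) 0<∣Cg∣ with nonempty? U'
  ... | no U'-empty = _ , _ , _ , exitEmpty U'-empty
  ... | yes U'≠∅ with 2 ℕ.* ∣ Cg ∣ ℕP.≤? ∣ next U' N ∣
  ...   | no small = _ , _ , _ , stop U'≠∅ (ℕP.≰⇒> small)
  ...   | yes big
          with U₁ , U'₁ , Cg₁ , g ← grow-exists {U = U ─ next U' N}
                 (smaller (next-shrinks {Cg} {U'} {N} 0<∣Cg∣ big))
                 (ℕP.<-≤-trans 0<∣Cg∣ (∣p∣≤∣p∪q∣ Cg _))
          = U₁ , U'₁ , Cg₁ , extend U'≠∅ big g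

  layer-exists : Acc ℕ._<_ ∣ U' ∣ → ∃[ U₂ ] ∃[ gs₂ ] Layer U U' gs U₂ gs₂
  layer-exists {U'} {U} {gs} (acc smaller) with nonempty? U'
  ... | no U'-empty = _ , _ , done U'-empty
  ... | yes (u , u∈U')
        with U₁ , U'₁ , Cg , g ← grow-exists {U = U - u} {N = ⁅ u ⁆} (<-wellFounded _)
                                   (Nonempty⇒∣p∣>0 (u , x∈⁅x⁆ u))
        with U₂ , gs₂ , l ← layer-exists {U = U₁} {gs = gs ++ [ Cg ]}
                              (smaller (ℕP.≤-<-trans (p⊆q⇒∣p∣≤∣q∣ (proj₂ (grow-⊆ g)))
                                                     (x∈p⇒∣p-x∣<∣p∣ u∈U')))
        = U₂ , gs₂ , pick u u∈U' g l

  run-exists : Acc ℕ._<_ ∣ U ∣ → ∃[ out ] Run U ls out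
  run-exists {U} {ls} (acc smaller) with nonempty? U
  ... | no U-empty = _ , finish U-empty
  ... | yes U≠∅
        with U₁ , gs , lay ← layer-exists {U = U} {gs = []} (<-wellFounded _)
        with out , run ← run-exists {ls = ls ++ [ gs ]}
                           (smaller (3*m≤2*n⇒m<n (layer-shrinks lay) (Nonempty⇒∣p∣>0 U≠∅)))
        = out , layer U≠∅ lay run

  -- U₀ is the set of unassigned points when the layer started.
  record LayerInvariant (U₀ U U' : Subset k) (gs : List (Subset k)) : Set where
    field
      U'⊆U               : U' ⊆ U
      U⊆U₀               : U ⊆ U₀
      covers             : ∀ {x} → x ∈ U₀ → x ∈ U ⊎ Any (x ∈_) gs
      groups⊆U₀          : All (_⊆ U₀) gs
      groups∩U=∅         : All (λ g → Disjoint g U) gs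
      groups-far-from-U' : All (λ g → Separated g U') gs
      groups-separated   : AllPairs Separated gs

  layer-start : LayerInvariant U₀ U₀ U₀ []
  layer-start = record
    { U'⊆U = id ; U⊆U₀ = id ; covers = inj₁
    ; groups⊆U₀ = [] ; groups∩U=∅ = [] ; groups-far-from-U' = [] ; groups-separated = [] }

  pick-preserves : LayerInvariant U₀ U U' gs → u ∈ U' →
                   Grow (U - u) (U' - u) ⁅ u ⁆ ⁅ u ⁆ U₁ U'₁ Cg →
                   LayerInvariant U₀ U₁ U'₁ (gs ++ [ Cg ])
  pick-preserves {U = U} {U'} {gs} {u} {U₁} {U'₁} {Cg} inv u∈U' g = record
    { U'⊆U               = grow-⊆-preserved (─-monoˡ-⊆ ⁅ u ⁆ U'⊆U) g
    ; U⊆U₀               = ⊆-trans U₁⊆U U⊆U₀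
    ; covers             = [ Sum.map₂ (++⁺ʳ gs ∘ Any.here) ∘ grow-covers g ∘ ∈-split ⁅ u ⁆
                           , inj₂ ∘ ++⁺ˡ ]′ ∘ covers
    ; groups⊆U₀          = All.++⁺ groups⊆U₀ (⊆-trans Cg⊆U' (⊆-trans U'⊆U U⊆U₀) ∷ [])
    ; groups∩U=∅         = All.++⁺ (All.map (Disjoint-⊆ʳ U₁⊆U) groups∩U=∅)
                                   (grow-disjoint Disjoint-─ g ∷ [])
    ; groups-far-from-U' = All.++⁺ (All.map (Separated-⊆ʳ U'₁⊆U') groups-far-from-U')
                                   (grow-separated (λ x∈⁅u⁆ _ _ → x∈⁅u⁆) g ∷ [])
    ; groups-separated   = AllPairs.++⁺ groups-separated ([] ∷ [])
                             (All.map (λ far → Separated-⊆ʳ Cg⊆U' far ∷ []) groups-far-from-U')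
    }
    where
    open LayerInvariant inv
    U₁⊆U : U₁ ⊆ U
    U₁⊆U = ⊆-trans (proj₁ (grow-⊆ g)) (p─q⊆p U ⁅ u ⁆)
    U'₁⊆U' : U'₁ ⊆ U'
    U'₁⊆U' = ⊆-trans (proj₂ (grow-⊆ g)) (p─q⊆p U' ⁅ u ⁆)
    Cg⊆U' : Cg ⊆ U'
    Cg⊆U' = grow-group-⊆ (x∈p⇒⁅x⁆⊆p u∈U') (p─q⊆p U' ⁅ u ⁆) g

  layer-invariant : Layer U U' gs U₂ gs₂ → LayerInvariant U₀ U U' gs →
                    ∃[ U'₂ ] LayerInvariant U₀ U₂ U'₂ gs₂
  layer-invariant (done _)          inv = _ , inv
  layer-invariant (pick u u∈U' g l) inv = layer-invariant l (pick-preserves inv u∈U' g)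

  LayersDisjoint : List (Subset k) → List (Subset k) → Set
  LayersDisjoint gs gs' = ∀ {g g'} → g ∈ₗ gs → g' ∈ₗ gs' → Disjoint g g'

  LayersDisjoint-sym : Symmetric LayersDisjoint
  LayersDisjoint-sym disj g∈ g'∈ x∈g x∈g' = disj g'∈ g∈ x∈g' x∈g

  record RunInvariant (U : Subset k) (ls : List (List (Subset k))) : Set where
    field
      covers           : ∀ x → x ∈ U ⊎ Any (Any (x ∈_)) ls
      groups∩U=∅       : All (All (λ g → Disjoint g U)) ls
      layers-disjoint  : AllPairs LayersDisjoint ls
      layers-separated : All (AllPairs Separated) ls

  run-start : RunInvariant ⊤ []
  run-start = record
    { covers = λ _ → inj₁ ∈⊤ ; groups∩U=∅ = [] ; layers-disjoint = [] ; layers-separated = [] }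

  layer-preserves : RunInvariant U ls → LayerInvariant U U₁ U'₁ gs → RunInvariant U₁ (ls ++ [ gs ])
  layer-preserves {U} {ls} {gs = gs} inv inv′ = record
    { covers           = [ Sum.map₂ (++⁺ʳ ls ∘ Any.here) ∘ L.covers , inj₂ ∘ ++⁺ˡ ]′ ∘ R.covers
    ; groups∩U=∅       = All.++⁺ (All.map (All.map (Disjoint-⊆ʳ L.U⊆U₀)) R.groups∩U=∅)
                                 (L.groups∩U=∅ ∷ [])
    ; layers-disjoint  = AllPairs.++⁺ R.layers-disjoint ([] ∷ [])
                           (All.map (λ L∩U=∅ → disjoint-from-new L∩U=∅ ∷ []) R.groups∩U=∅)
    ; layers-separated = All.++⁺ R.layers-separated (L.groups-separated ∷ [])
    }
    where
    module R = RunInvariant inv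
    module L = LayerInvariant inv′
    disjoint-from-new : ∀ {L} → All (λ g → Disjoint g U) L → LayersDisjoint L gs
    disjoint-from-new L∩U=∅ g∈L g′∈gs x∈g = All.lookup L∩U=∅ g∈L x∈g ∘ All.lookup L.groups⊆U₀ g′∈gs

  run-invariant : Run U ls out → RunInvariant U ls → ∃[ U∞ ] Empty U∞ × RunInvariant U∞ out
  run-invariant (finish U-empty)  inv = _ , U-empty , inv
  run-invariant (layer _ lay run) inv =
    run-invariant run (layer-preserves inv (proj₂ (layer-invariant lay layer-start)))

  GrownGroup : Subset k → Set
  GrownGroup Cg = ∃[ U ] ∃[ U' ] ∃[ u ] ∃[ U₁ ] ∃[ U'₁ ] Grow (U - u) (U' - u) ⁅ u ⁆ ⁅ u ⁆ U₁ U'₁ Cg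

  layer-grown : Layer U U' gs U₂ gs₂ → All GrownGroup gs → All GrownGroup gs₂
  layer-grown (done _)       grown = grown
  layer-grown (pick u _ g l) grown = layer-grown l (All.++⁺ grown ((_ , _ , u , _ , _ , g) ∷ []))

  run-grown : Run U ls out → All (All GrownGroup) ls → All (All GrownGroup) out
  run-grown (finish _)        grown = grown
  run-grown (layer _ lay run) grown = run-grown run (All.++⁺ grown (layer-grown lay [] ∷ []))

module Geometry {k : ℕ} {d : Fin k → Fin k → ℚ} (metric : IsMetric d) (r : ℚ) (0≤2r : 0ℚ ≤ two * r)
  where
  open IsMetric metric using (triangle; zero⇔eq₂) renaming (sym to d-sym)
  open Algorithm d r
  open Loops d r

  instance
    2r-nonNegative : NonNegative (two * r)
    2r-nonNegative = nonNegative 0≤2r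

  variable
    A : Subset k
    t m : ℕ

  Separated-sym : Symmetric Separated
  Separated-sym sep x∈B y∈A = subst (two * r <_) (d-sym _ _) (sep y∈A x∈B)

  Separated⇒Disjoint : ∀ {A B} → Separated A B → Disjoint A B
  Separated⇒Disjoint sep {x} x∈A x∈B =
    ℚP.<-irrefl refl (ℚP.≤-<-trans 0≤2r (subst (two * r <_) (zero⇔eq₂ x) (sep x∈A x∈B)))

  WithinRounds : Fin k → ℕ → Subset k → Set
  WithinRounds u t A = ∀ {x} → x ∈ A → d u x ≤ ℕ→ℚ t * (two * r)

  WithinRounds-mono : t ℕ.≤ m → WithinRounds u t A → WithinRounds u m A
  WithinRounds-mono t≤m within x∈A =
    ℚP.≤-trans (within x∈A) (ℚP.*-monoʳ-≤-nonNeg (two * r) (ℕ→ℚ-mono-≤ t≤m))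

  seed-within : ∀ u → WithinRounds u 0 ⁅ u ⁆
  seed-within u x∈⁅u⁆ rewrite x∈⁅y⁆⇒x≡y u x∈⁅u⁆ =
    ℚP.≤-reflexive (trans (zero⇔eq₂ u) (sym (ℚP.*-zeroˡ (two * r))))

  grow-radius : N ⊆ Cg → Disjoint Cg U' → 3 ^ t ℕ.≤ ∣ Cg ∣ → WithinRounds u t Cg →
                Grow U U' Cg N U₁ U'₁ Cg₁ → ∃[ t′ ] 3 ^ t′ ℕ.≤ ∣ Cg₁ ∣ × WithinRounds u t′ Cg₁
  grow-radius {t = t} _ _ size within (exitEmpty _) = t , size , within
  grow-radius {t = t} _ _ size within (stop _ _)    = t , size , within
  grow-radius {N} {Cg} {U'} {t} {u} N⊆Cg Cg∩U'=∅ size within (extend _ big g) =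
    grow-radius {t = suc t} (q⊆p∪q Cg X) (Disjoint-∪-─ X Cg∩U'=∅) size′ within′ g
    where
    X : Subset k
    X = next U' N
    size′ : 3 ^ suc t ℕ.≤ ∣ Cg ∪ X ∣
    size′ = begin
      3 ℕ.* 3 ^ t                ≤⟨ ℕP.*-monoʳ-≤ 3 size ⟩
      ∣ Cg ∣ ℕ.+ 2 ℕ.* ∣ Cg ∣    ≤⟨ ℕP.+-monoʳ-≤ ∣ Cg ∣ big ⟩
      ∣ Cg ∣ ℕ.+ ∣ X ∣           ≤⟨ Disjoint⇒∣p∣+∣q∣≤∣p∪q∣ Cg X Cg∩X=∅ ⟩
      ∣ Cg ∪ X ∣                 ∎
      where
      open ℕP.≤-Reasoning
      Cg∩X=∅ : Disjoint Cg X
      Cg∩X=∅ = Disjoint-⊆ʳ (next⊆ {U'} {N}) Cg∩U'=∅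
    within′ : WithinRounds u (suc t) (Cg ∪ X)
    within′ {x} x∈Cg∪X with x∈p∪q⁻ Cg X x∈Cg∪X
    ... | inj₁ x∈Cg = WithinRounds-mono (ℕP.n≤1+n t) within x∈Cg
    ... | inj₂ x∈X with _ , v , v∈N , close ← ∈-next⁻ {U'} {N} x∈X = begin
      d u x                          ≤⟨ triangle u v x ⟩
      d u v + d v x                  ≤⟨ ℚP.+-mono-≤ (within (N⊆Cg v∈N)) close ⟩
      ℕ→ℚ t * (two * r) + two * r    ≡⟨ sym (ℕ→ℚ-suc-* t (two * r)) ⟩
      ℕ→ℚ (suc t) * (two * r)        ∎
      where open ℚP.≤-Reasoning

  grown-group-rounds : GrownGroup Cg → ∃[ u ] ∃[ t ] 3 ^ t ℕ.≤ ∣ Cg ∣ × WithinRounds u t Cg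
  grown-group-rounds (_ , U' , u , _ , _ , g) =
    u , grow-radius {t = 0} id (Disjoint-─ {p = U'}) (ℕP.≤-reflexive (sym (∣⁅x⁆∣≡1 u)))
                    (seed-within u) g

  DiameterAtMost : ℚ → Subset k → Set
  DiameterAtMost h A = ∀ {x y} → x ∈ A → y ∈ A → d x y ≤ h

  WithinRounds⇒DiameterAtMost : WithinRounds u m A → DiameterAtMost (ℕ→ℚ 4 * r * ℕ→ℚ m) A
  WithinRounds⇒DiameterAtMost {u} {m} within {x} {y} x∈A y∈A = begin
    d x y                                   ≤⟨ triangle x u y ⟩
    d x u + d u y                           ≡⟨ cong (_+ d u y) (d-sym x u) ⟩
    d u x + d u y                           ≤⟨ ℚP.+-mono-≤ (within x∈A) (within y∈A) ⟩
    ℕ→ℚ m * (two * r) + ℕ→ℚ m * (two * r)   ≡⟨ double (ℕ→ℚ m) r ⟩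
    ℕ→ℚ 4 * r * ℕ→ℚ m                       ∎
    where
    open ℚP.≤-Reasoning
    double : ∀ x r → x * (two * r) + x * (two * r) ≡ ℕ→ℚ 4 * r * x
    double = solve 2 (λ x r → x :* (con two :* r) :+ x :* (con two :* r)
                              := con (ℕ→ℚ 4) :* r :* x) refl
      where open +-*-Solver

  grown-group-diameter : k ℕ.< 3 ^ suc m → GrownGroup Cg → DiameterAtMost (ℕ→ℚ 4 * r * ℕ→ℚ m) Cg
  grown-group-diameter {m} {Cg} k<3^[1+m] grown
    with u , t , size , within ← grown-group-rounds grown =
    WithinRounds⇒DiameterAtMost {m = m} (WithinRounds-mono {t = t} {m = m} t≤m within)
    where
    t≤m : t ℕ.≤ m
    t≤m = 3^t≤n<3^[1+m]⇒t≤m (ℕP.≤-trans size (∣p∣≤n Cg)) k<3^[1+m]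

  well-separated : ∀ {h U out} → Empty U → RunInvariant U out → All (All (DiameterAtMost h)) out →
                   IsWellSeparatedPartition d r out (λ _ → h)
  well-separated {out = out} U-empty inv bounded = record
    { disjoint  = disjoint
    ; covering  = covering
    ; separated = λ i _ _ _ _ j≢j′ → AllPairs-lookup Separated-sym (layer-separated i) j≢j′
    ; diameter  = λ i j _ _ → All-lookup (All-lookup bounded i) j
    }
    where
    open RunInvariant inv
    layer-separated : ∀ i → AllPairs Separated (List.lookup out i)
    layer-separated = All-lookup layers-separated
    disjoint : ∀ i j i′ j′ x → x ∈ Group out i j → x ∈ Group out i′ j′ →
               (Fin.toℕ i ≡ Fin.toℕ i′) × (Fin.toℕ j ≡ Fin.toℕ j′)
    disjoint i j i′ j′ x x∈ x∈′ with i Fin.≟ i′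
    ... | no i≢i′ = ⊥-elim (AllPairs-lookup LayersDisjoint-sym layers-disjoint i≢i′
                                            (∈-lookup j) (∈-lookup j′) x∈ x∈′)
    ... | yes refl with j Fin.≟ j′
    ...   | no j≢j′ =
      ⊥-elim (Separated⇒Disjoint (AllPairs-lookup Separated-sym (layer-separated i) j≢j′) x∈ x∈′)
    ...   | yes refl = refl , refl
    covering : ∀ x → ∃[ i ] ∃[ j ] x ∈ Group out i j
    covering x with covers x
    ... | inj₁ x∈U   = ⊥-elim (U-empty (x , x∈U))
    ... | inj₂ x∈out =
      Any.index x∈out , Any.index (lookup-index x∈out) , lookup-index (lookup-index x∈out)

lemma17 : (k : ℕ) → k ≥ 1 → (d : Fin k → Fin k → ℚ) → IsMetric d →
          (r : ℚ) → 0ℚ < r →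
          (m₁ m₂ : ℕ) → IsFloorLog 3 2 k m₁ → IsFloorLog 3 1 k m₂ →
          (∃ λ out → Algorithm.Output d r out)
          × (∀ out → Algorithm.Output d r out →
               (length out ℕ.≤ suc m₁)
               × IsWellSeparatedPartition d r out (λ _ → ℕ→ℚ 4 * r * ℕ→ℚ m₂))
lemma17 k _ d metric r 0<r m₁ m₂ (_ , k*2^[1+m₁]<3^[1+m₁]) (_ , k*1^[1+m₂]<3^[1+m₂]) =
  run-exists (<-wellFounded _) ,
  λ out run → run-length run (suc m₁) 2^[1+m₁]*k<3^[1+m₁] , partition run
  where
  open Loops d r
  0≤2r : 0ℚ ≤ two * r
  0≤2r = ℚP.*-monoˡ-≤-nonNeg two (ℚP.<⇒≤ 0<r)
  open Geometry metric r 0≤2r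
  2^[1+m₁]*k<3^[1+m₁] : 2 ^ suc m₁ ℕ.* ∣ ⊤ {k} ∣ ℕ.< 3 ^ suc m₁
  2^[1+m₁]*k<3^[1+m₁] rewrite ∣⊤∣≡n k = subst (ℕ._< 3 ^ suc m₁) (ℕP.*-comm k _) k*2^[1+m₁]<3^[1+m₁]
  k<3^[1+m₂] : k ℕ.< 3 ^ suc m₂
  k<3^[1+m₂] = subst (ℕ._< 3 ^ suc m₂)
                     (trans (cong (k ℕ.*_) (ℕP.^-zeroˡ (suc m₂))) (ℕP.*-identityʳ k))
                     k*1^[1+m₂]<3^[1+m₂]
  partition : ∀ {out} → Algorithm.Output d r out →
              IsWellSeparatedPartition d r out (λ _ → ℕ→ℚ 4 * r * ℕ→ℚ m₂)
  partition run with _ , U-empty , inv ← run-invariant run run-start =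
    well-separated U-empty inv
      (All.map (All.map (grown-group-diameter {m = m₂} k<3^[1+m₂])) (run-grown run []))
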